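{- Let $q$ be a prime power, $r\geqslant2$, $\mathcal{A}\subseteq\mathbb{F}_{q^r}$, and $e_1,e_2\mid q^r-1$. Let $E=\mathrm{lcm}(e_1,e_2)$ and $e=\gcd(e_1,e_2)$. Then $$N(E,\mathcal{A})\geqslant N(e_1,\mathcal{A})+N(e_2,\mathcal{A})-N(e,\mathcal{A}).$$
   Context: An element $\gamma\in\mathbb{F}_{q^r}^*$ is $m$-free (for $m\mid q^r-1$) if there is no $\beta\in\mathbb{F}_{q^r}^*$ with $\gamma=\beta^{d}$ for some $d\mid m$, $d\neq1$. $N(m,\mathcal{A})$ is the number of $m$-free elements of $\mathcal{A}$. -}

module Defs where

open import Level using (_⊔_)
open import Algebra.Bundles using (CommutativeRing)
open import Data.Nat using (ℕ; zero; suc)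
open import Data.Nat.Divisibility using (_∣_)
open import Data.Fin using (Fin)
open import Data.Fin.Subset using (Subset; _∈_; ∣_∣)
open import Data.Product using (_×_; ∃; Σ)
open import Relation.Nullary using (¬_)
open import Relation.Binary.PropositionalEquality using (_≡_; _≢_)
open import Relation.Binary.Definitions using (Decidable)
open import Function.Bundles using (_⇔_)

record IsFiniteField {c ℓ} (F : CommutativeRing c ℓ) (n : ℕ) : Set (c ⊔ ℓ) where
  open CommutativeRing F
  field
    0≉1       : ¬ (0# ≈ 1#)
    inverse   : ∀ x → ¬ (x ≈ 0#) → ∃ λ y → x * y ≈ 1#
    _≟_       : Decidable _≈_
    enum      : Fin n → Carrier
    enum-inj  : ∀ i j → enum i ≈ enum j → i ≡ j
    enum-surj : ∀ x → ∃ λ i → enum i ≈ x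

module _ {c ℓ} (F : CommutativeRing c ℓ) where
  open CommutativeRing F

  pow : Carrier → ℕ → Carrier
  pow x zero    = 1#
  pow x (suc d) = x * pow x d

  IsFree : ℕ → Carrier → Set (c ⊔ ℓ)
  IsFree m γ = ¬ (γ ≈ 0#) ×
    (∀ (d : ℕ) (β : Carrier) → d ∣ m → d ≢ 1 → ¬ (β ≈ 0#) → ¬ (γ ≈ pow β d))

  -- N(m, A) ≡ k : exactly k elements of A (a subset of F, given as a subset
  -- of indices along the enumeration) are m-free.
  NFree : {n : ℕ} → (Fin n → Carrier) → ℕ → Subset n → ℕ → Set (c ⊔ ℓ)
  NFree {n} enum m A k = Σ (Subset n) λ S →
    (∀ i → (i ∈ S) ⇔ ((i ∈ A) × IsFree m (enum i))) × (∣ S ∣ ≡ k)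

{-# OPTIONS --safe #-}

-- An element that is both e₁-free and e₂-free is lcm(e₁,e₂)-free: a d-th power with
-- d ≠ 1 is a p-th power for some prime p ∣ d, and a prime dividing lcm(e₁,e₂) divides
-- e₁ or e₂. Moreover freeness passes to divisors, so an e₁-free or e₂-free element is
-- gcd(e₁,e₂)-free. With S₁, S₂ the e₁- and e₂-free elements of 𝒜, inclusion–exclusion
-- gives N(e₁) + N(e₂) = |S₁ ∩ S₂| + |S₁ ∪ S₂| ≤ N(E) + N(e).

module Submission where

open import Defs
open import Algebra.Bundles using (CommutativeRing)
open import Data.Nat using (ℕ; _+_; _*_; _^_; _∸_; _≤_)
open import Data.Nat.Divisibility using (_∣_)
open import Data.Nat.Primality using (Prime)
open import Data.Nat.GCD using (gcd)
open import Data.Nat.LCM using (lcm)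
open import Data.Fin.Subset using (Subset)
open import Data.Product using (∃₂; _×_)
open import Relation.Binary.PropositionalEquality using (_≡_)

open import Data.Nat using (zero; suc; nonTrivial⇒≢1)
open import Data.Nat.Properties using (+-suc; +-mono-≤; module ≤-Reasoning)
open import Data.Nat.Divisibility using (divides; ∣-trans; _∣0; m∣m*n; n∣m*n)
open import Data.Nat.Primality using (prime[2]; prime⇒nonTrivial; euclidsLemma)
open import Data.Nat.Primality.Factorisation using (factorise)
open import Data.Nat.GCD using (gcd[m,n]∣m; gcd[m,n]∣n)
open import Data.Nat.LCM using (lcm-least)
open import Data.Nat.ListAction using (product)
open import Data.List using ([]; _∷_)
open import Data.List.Relation.Unary.All using (_∷_)
open import Data.Vec using ([]; _∷_)
open import Data.Fin.Subset using (_∩_; _∪_; _⊆_; ∣_∣; inside; outside)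
open import Data.Fin.Subset.Properties using (x∈p∩q⁻; x∈p∪q⁻; p⊆q⇒∣p∣≤∣q∣)
open import Data.Product using (∃; _,_; map₂)
open import Data.Sum using (_⊎_; inj₁; inj₂; [_,_]′)
open import Relation.Nullary using (¬_; contradiction)
open import Relation.Binary.PropositionalEquality using (_≢_; refl; cong; sym; subst; module ≡-Reasoning)
open import Function.Base using (_∘_)
open import Function.Bundles using (Equivalence)
open import Level using (_⊔_)
import Relation.Binary.Reasoning.Setoid as SetoidReasoning

≢1⇒∃prime∣ : ∀ {d} → d ≢ 1 → ∃ λ p → Prime p × p ∣ d
≢1⇒∃prime∣ {zero} _ = 2 , prime[2] , 2 ∣0
≢1⇒∃prime∣ {suc d} d≢1 with factorise (suc d)
... | record { factors = [] ; isFactorisation = d≡1 } = contradiction d≡1 d≢1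
... | record { factors = p ∷ ps ; isFactorisation = d≡p*ps ; factorsPrime = p-prime ∷ _ } =
  p , p-prime , subst (p ∣_) (sym d≡p*ps) (m∣m*n (product ps))

prime∣lcm⇒∣⊎∣ : ∀ {p} m n → Prime p → p ∣ lcm m n → (p ∣ m) ⊎ (p ∣ n)
prime∣lcm⇒∣⊎∣ m n p-prime p∣lcm =
  euclidsLemma m n p-prime (∣-trans p∣lcm (lcm-least (m∣m*n {m} n) (n∣m*n m)))

∣p∩q∣+∣p∪q∣≡∣p∣+∣q∣ : ∀ {n} (p q : Subset n) → ∣ p ∩ q ∣ + ∣ p ∪ q ∣ ≡ ∣ p ∣ + ∣ q ∣
∣p∩q∣+∣p∪q∣≡∣p∣+∣q∣ []            []            = refl
∣p∩q∣+∣p∪q∣≡∣p∣+∣q∣ (inside ∷ p)  (inside ∷ q)  = begin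
  suc (∣ p ∩ q ∣ + suc ∣ p ∪ q ∣) ≡⟨ cong suc (+-suc ∣ p ∩ q ∣ ∣ p ∪ q ∣) ⟩
  suc (suc (∣ p ∩ q ∣ + ∣ p ∪ q ∣)) ≡⟨ cong (suc ∘ suc) (∣p∩q∣+∣p∪q∣≡∣p∣+∣q∣ p q) ⟩
  suc (suc (∣ p ∣ + ∣ q ∣)) ≡⟨ cong suc (sym (+-suc ∣ p ∣ ∣ q ∣)) ⟩
  suc (∣ p ∣ + suc ∣ q ∣) ∎
  where open ≡-Reasoning
∣p∩q∣+∣p∪q∣≡∣p∣+∣q∣ (inside ∷ p)  (outside ∷ q) = begin
  ∣ p ∩ q ∣ + suc ∣ p ∪ q ∣ ≡⟨ +-suc ∣ p ∩ q ∣ ∣ p ∪ q ∣ ⟩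
  suc (∣ p ∩ q ∣ + ∣ p ∪ q ∣) ≡⟨ cong suc (∣p∩q∣+∣p∪q∣≡∣p∣+∣q∣ p q) ⟩
  suc (∣ p ∣ + ∣ q ∣) ∎
  where open ≡-Reasoning
∣p∩q∣+∣p∪q∣≡∣p∣+∣q∣ (outside ∷ p) (inside ∷ q)  = begin
  ∣ p ∩ q ∣ + suc ∣ p ∪ q ∣ ≡⟨ +-suc ∣ p ∩ q ∣ ∣ p ∪ q ∣ ⟩
  suc (∣ p ∩ q ∣ + ∣ p ∪ q ∣) ≡⟨ cong suc (∣p∩q∣+∣p∪q∣≡∣p∣+∣q∣ p q) ⟩
  suc (∣ p ∣ + ∣ q ∣) ≡⟨ sym (+-suc ∣ p ∣ ∣ q ∣) ⟩
  ∣ p ∣ + suc ∣ q ∣ ∎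
  where open ≡-Reasoning
∣p∩q∣+∣p∪q∣≡∣p∣+∣q∣ (outside ∷ p) (outside ∷ q) = ∣p∩q∣+∣p∪q∣≡∣p∣+∣q∣ p q

∣p∣+∣q∣≤∣r∣+∣s∣ : ∀ {n} {p q r s : Subset n} → p ∩ q ⊆ r → p ∪ q ⊆ s →
                  ∣ p ∣ + ∣ q ∣ ≤ ∣ r ∣ + ∣ s ∣
∣p∣+∣q∣≤∣r∣+∣s∣ {p = p} {q} {r} {s} p∩q⊆r p∪q⊆s = begin
  ∣ p ∣ + ∣ q ∣         ≡⟨ sym (∣p∩q∣+∣p∪q∣≡∣p∣+∣q∣ p q) ⟩
  ∣ p ∩ q ∣ + ∣ p ∪ q ∣ ≤⟨ +-mono-≤ (p⊆q⇒∣p∣≤∣q∣ p∩q⊆r) (p⊆q⇒∣p∣≤∣q∣ p∪q⊆s) ⟩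
  ∣ r ∣ + ∣ s ∣         ∎
  where open ≤-Reasoning

module _ {c ℓ} (F : CommutativeRing c ℓ) where
  open CommutativeRing F
    using (_≈_; 0#; 1#; setoid; semiring; *-identityˡ; *-congˡ; *-congʳ; *-comm; *-assoc; zeroʳ)
    renaming (_*_ to _·_; sym to ≈-sym; trans to ≈-trans)

  NoZeroDivisors : Set (c ⊔ ℓ)
  NoZeroDivisors = ∀ {x y} → ¬ x ≈ 0# → ¬ y ≈ 0# → ¬ x · y ≈ 0#

  inverses⇒noZeroDivisors : (∀ x → ¬ x ≈ 0# → ∃ λ y → x · y ≈ 1#) → NoZeroDivisors
  inverses⇒noZeroDivisors inverse {x} {y} x≉0 y≉0 xy≈0 =
    let (x⁻¹ , xx⁻¹≈1) = inverse x x≉0 in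
    y≉0 (begin
      y             ≈⟨ *-identityˡ y ⟨
      1# · y        ≈⟨ *-congʳ xx⁻¹≈1 ⟨
      x · x⁻¹ · y   ≈⟨ *-congʳ (*-comm x x⁻¹) ⟩
      x⁻¹ · x · y   ≈⟨ *-assoc x⁻¹ x y ⟩
      x⁻¹ · (x · y) ≈⟨ *-congˡ xy≈0 ⟩
      x⁻¹ · 0#      ≈⟨ zeroʳ x⁻¹ ⟩
      0#            ∎)
    where open SetoidReasoning setoid

  pow-assoc : ∀ x m n → pow F (pow F x m) n ≈ pow F x (m * n)
  pow-assoc x m n = begin
    pow F (pow F x m) n ≡⟨ pow≡^ (pow F x m) n ⟩
    pow F x m Exp.^ n   ≡⟨ cong (Exp._^ n) (pow≡^ x m) ⟩
    (x Exp.^ m) Exp.^ n ≈⟨ Exp.^-assocʳ x m n ⟩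
    x Exp.^ (m * n)     ≡⟨ pow≡^ x (m * n) ⟨
    pow F x (m * n)     ∎
    where
    open SetoidReasoning setoid
    import Algebra.Properties.Semiring.Exp semiring as Exp
    pow≡^ : ∀ x n → pow F x n ≡ x Exp.^ n
    pow≡^ x zero    = refl
    pow≡^ x (suc n) = cong (x ·_) (pow≡^ x n)

  module IntegralDomain (0≉1 : ¬ 0# ≈ 1#) (noZeroDivisors : NoZeroDivisors) where

    pow-nonzero : ∀ {x} n → ¬ x ≈ 0# → ¬ pow F x n ≈ 0#
    pow-nonzero zero    x≉0 1≈0 = 0≉1 (≈-sym 1≈0)
    pow-nonzero (suc n) x≉0     = noZeroDivisors x≉0 (pow-nonzero n x≉0)

    isFree-∣ : ∀ {m n γ} → m ∣ n → IsFree F n γ → IsFree F m γ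
    isFree-∣ m∣n (γ≉0 , free) = γ≉0 , λ d β d∣m → free d β (∣-trans d∣m m∣n)

    -- A d-th power with p ∣ d is a p-th power, so only prime exponents need checking.
    isFree-fromPrimes : ∀ {m γ} → ¬ γ ≈ 0# →
      (∀ p β → Prime p → p ∣ m → ¬ β ≈ 0# → ¬ γ ≈ pow F β p) → IsFree F m γ
    isFree-fromPrimes {m} {γ} γ≉0 free = γ≉0 , notPower
      where
      notPower : ∀ d β → d ∣ m → d ≢ 1 → ¬ β ≈ 0# → ¬ γ ≈ pow F β d
      notPower d β d∣m d≢1 β≉0 γ≈βᵈ with ≢1⇒∃prime∣ d≢1
      ... | p , p-prime , divides k refl =
        free p (pow F β k) p-prime (∣-trans (n∣m*n k) d∣m) (pow-nonzero k β≉0)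
          (≈-trans γ≈βᵈ (≈-sym (pow-assoc β k p)))

    isFree-lcm : ∀ {m n γ} → IsFree F m γ → IsFree F n γ → IsFree F (lcm m n) γ
    isFree-lcm {m} {n} (γ≉0 , free₁) (_ , free₂) = isFree-fromPrimes γ≉0 λ p β p-prime p∣lcm →
      let p≢1 = nonTrivial⇒≢1 {{prime⇒nonTrivial p-prime}} in
      [ (λ p∣m → free₁ p β p∣m p≢1) , (λ p∣n → free₂ p β p∣n p≢1) ]′
        (prime∣lcm⇒∣⊎∣ m n p-prime p∣lcm)

-- The hypotheses on q, r and e₁, e₂ ∣ q ^ r ∸ 1 are deliberately unused: the inequality
-- holds in every field, for all e₁, e₂.
lemma5 : ∀ {c ℓ} (q r : ℕ) → (∃₂ λ p k → Prime p × 1 ≤ k × q ≡ p ^ k) → 2 ≤ r →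
    (F : CommutativeRing c ℓ) (FF : IsFiniteField F (q ^ r)) →
    (A : Subset (q ^ r)) (e₁ e₂ : ℕ) → e₁ ∣ q ^ r ∸ 1 → e₂ ∣ q ^ r ∸ 1 →
    (nE n₁ n₂ ne : ℕ) →
    NFree F (IsFiniteField.enum FF) (lcm e₁ e₂) A nE →
    NFree F (IsFiniteField.enum FF) e₁ A n₁ →
    NFree F (IsFiniteField.enum FF) e₂ A n₂ →
    NFree F (IsFiniteField.enum FF) (gcd e₁ e₂) A ne →
    n₁ + n₂ ≤ nE + ne
lemma5 _ _ _ _ F FF _ e₁ e₂ _ _ _ _ _ _ (S , S⇔ , refl) (S₁ , S₁⇔ , refl) (S₂ , S₂⇔ , refl) (T , T⇔ , refl) =
  ∣p∣+∣q∣≤∣r∣+∣s∣ S₁∩S₂⊆S S₁∪S₂⊆T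
  where
  open IsFiniteField FF using (0≉1; inverse)
  open IntegralDomain F 0≉1 (inverses⇒noZeroDivisors F inverse)
  open Equivalence

  S₁∩S₂⊆S : S₁ ∩ S₂ ⊆ S
  S₁∩S₂⊆S {i} i∈S₁∩S₂ =
    let (i∈S₁ , i∈S₂) = x∈p∩q⁻ S₁ S₂ i∈S₁∩S₂
        (i∈A , free₁) = to (S₁⇔ i) i∈S₁
        (_ , free₂)   = to (S₂⇔ i) i∈S₂
    in from (S⇔ i) (i∈A , isFree-lcm free₁ free₂)

  S₁∪S₂⊆T : S₁ ∪ S₂ ⊆ T
  S₁∪S₂⊆T {i} i∈S₁∪S₂ with x∈p∪q⁻ S₁ S₂ i∈S₁∪S₂
  ... | inj₁ i∈S₁ = from (T⇔ i) (map₂ (isFree-∣ (gcd[m,n]∣m e₁ e₂)) (to (S₁⇔ i) i∈S₁))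
  ... | inj₂ i∈S₂ = from (T⇔ i) (map₂ (isFree-∣ (gcd[m,n]∣n e₁ e₂)) (to (S₂⇔ i) i∈S₂))
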